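{- Let $x,\rho,\sigma$ be complex numbers (or indeterminates), and let $(a_{i,j})_{i,j\ge0}$ be the sequence defined by the recurrence $$a_{i,j}=a_{i-1,j}+a_{i,j-1}+x\,a_{i-1,j-1},\qquad i,j\ge1,$$ together with the initial conditions $a_{i,0}=\rho^i$ and $a_{0,i}=\sigma^i$ for all $i\ge0$. Then for every integer $n\ge1$, $$\det_{0\le i,j\le n-1}(a_{i,j})=(1+x)^{\binom{n-1}{2}}\,(x+\rho+\sigma-\rho\sigma)^{n-1}.$$ -}

module Defs where

open import Level using (Level)
open import Algebra.Bundles using (CommutativeRing)
open import Data.Nat using (ℕ; zero; suc)
open import Data.Fin using (Fin; zero; suc; punchIn; toℕ)

module RingDefs {c ℓ : Level} (R : CommutativeRing c ℓ) where
  open CommutativeRing R using (Carrier; _+_; _*_; -_; 0#; 1#)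

  pow : Carrier → ℕ → Carrier
  pow x zero    = 1#
  pow x (suc k) = x * pow x k

  sumFin : (n : ℕ) → (Fin n → Carrier) → Carrier
  sumFin zero    f = 0#
  sumFin (suc n) f = f zero + sumFin n (λ j → f (suc j))

  minor : {n : ℕ} → (Fin (suc n) → Fin (suc n) → Carrier) → Fin (suc n) →
          Fin n → Fin n → Carrier
  minor M j i k = M (suc i) (punchIn j k)

  det : (n : ℕ) → (Fin n → Fin n → Carrier) → Carrier
  det zero    M = 1#
  det (suc n) M = sumFin (suc n) (λ j → pow (- 1#) (toℕ j) * (M zero j * det n (minor M j)))

module Submission where

-- Adding −ρ times each row to the next one preserves the determinant.  As a i 0 = ρⁱ, this clears
-- the first column below a 0 0 = 1 and leaves the array c i j = a (i+1) (j+1) − ρ a i (j+1), which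
-- satisfies the same recurrence and has constant first column c i 0 = c 0 0 = x + ρ + σ − ρσ.  On
-- such an array the same step with ρ = 1 splits off a factor c 0 0 and leaves an array of the same
-- kind with corner (1 + x) c 0 0, so by induction its n × n determinant is c₀₀ⁿ (1 + x)^(n choose 2).
-- The row operation needs only the Laplace expansion along the first row: the determinant is linear
-- in the first row, and it vanishes when the first two rows agree, because the double expansion
-- along them cancels in pairs.

open import Defs
open import Level using (Level)
open import Algebra.Bundles using (CommutativeRing)
open import Data.Nat using (ℕ; zero; suc; _∸_; _≤_)
import Data.Nat as ℕ
open import Data.Nat.Combinatorics using (_C_; nC1≡n; nCk+nC[k+1]≡[n+1]C[k+1])
open import Data.Fin using (Fin; zero; suc; toℕ; punchIn; inject₁; lift)
open import Data.Fin.Properties using (toℕ-inject₁)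
open import Data.Vec.Functional using (_∷_; tail)
open import Function using (_∘_)
open import Relation.Binary.Core using (_Preserves_⟶_)
import Relation.Binary.PropositionalEquality as ≡
open ≡ using (_≡_; _≗_)

module Determinant {c ℓ : Level} (R : CommutativeRing c ℓ) where
  open CommutativeRing R hiding (zero)
  open RingDefs R
  open import Algebra.Properties.Ring ring using (-1*x≈-x; -‿involutive)
  open import Algebra.Properties.Semiring.Sum semiring
    using (sum; sum-cong-≋; sum-replicate-zero; ∑-distrib-+; *-distribˡ-sum)
  open import Algebra.Solver.Ring.NaturalCoefficients.Default commutativeSemiring
  open import Relation.Binary.Reasoning.Setoid setoid

  Matrix : ℕ → Set c
  Matrix n = Fin n → Fin n → Carrier

  sign : ∀ {n} → Fin n → Carrier
  sign j = pow (- 1#) (toℕ j)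

  sumFin≡sum : ∀ n (f : Fin n → Carrier) → sumFin n f ≡ sum f
  sumFin≡sum zero    f = ≡.refl
  sumFin≡sum (suc n) f = ≡.cong (f zero +_) (sumFin≡sum n (f ∘ suc))

  sum-≈0 : ∀ {n} {f : Fin n → Carrier} → (∀ i → f i ≈ 0#) → sum f ≈ 0#
  sum-≈0 {n} f≈0 = trans (sum-cong-≋ f≈0) (sum-replicate-zero n)

  sum-linear : ∀ {n} (f g : Fin n → Carrier) μ →
               sum (λ i → f i + μ * g i) ≈ sum f + μ * sum g
  sum-linear f g μ = trans (∑-distrib-+ f (λ i → μ * g i)) (+-congˡ (sym (*-distribˡ-sum μ g)))

  det-expand : ∀ n (M : Matrix (suc n)) →
               det (suc n) M ≈ sum (λ j → sign j * (M zero j * det n (minor M j)))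
  det-expand n M = reflexive (sumFin≡sum (suc n) (λ j → sign j * (M zero j * det n (minor M j))))

  term-cong : ∀ {n} (j : Fin n) {y y′ d d′} → y ≈ y′ → d ≈ d′ → sign j * (y * d) ≈ sign j * (y′ * d′)
  term-cong j y≈y′ d≈d′ = *-congˡ (*-cong y≈y′ d≈d′)

  term-congʳ : ∀ {n} (j : Fin n) y {d d′} → d ≈ d′ → sign j * (y * d) ≈ sign j * (y * d′)
  term-congʳ j y = term-cong j refl

  det-cong : ∀ n {M N : Matrix n} → (∀ i j → M i j ≈ N i j) → det n M ≈ det n N
  det-cong zero    M≈N = refl
  det-cong (suc n) {M} {N} M≈N = begin
    det (suc n) M
      ≈⟨ det-expand n M ⟩
    sum (λ j → sign j * (M zero j * det n (minor M j)))
      ≈⟨ sum-cong-≋ (λ j → term-cong j (M≈N zero j) (det-cong n (λ i k → M≈N (suc i) (punchIn j k)))) ⟩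
    sum (λ j → sign j * (N zero j * det n (minor N j)))
      ≈⟨ det-expand n N ⟨
    det (suc n) N
      ∎

  det-linearFirstRow : ∀ n (u w : Fin (suc n) → Carrier) μ (T : Fin n → Fin (suc n) → Carrier) →
    det (suc n) ((λ j → u j + μ * w j) ∷ T) ≈ det (suc n) (u ∷ T) + μ * det (suc n) (w ∷ T)
  det-linearFirstRow n u w μ T = begin
    det (suc n) ((λ j → u j + μ * w j) ∷ T)
      ≈⟨ det-expand n ((λ j → u j + μ * w j) ∷ T) ⟩
    sum (λ j → sign j * ((u j + μ * w j) * D j))
      ≈⟨ sum-cong-≋ (λ j → distribute (sign j) (u j) (w j) (D j)) ⟩
    sum (λ j → U j + μ * W j)
      ≈⟨ sum-linear U W μ ⟩
    sum U + μ * sum W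
      ≈⟨ +-cong (det-expand n (u ∷ T)) (*-congˡ (det-expand n (w ∷ T))) ⟨
    det (suc n) (u ∷ T) + μ * det (suc n) (w ∷ T)
      ∎
    where
    D U W : Fin (suc n) → Carrier
    D j = det n (λ i k → T i (punchIn j k))
    U j = sign j * (u j * D j)
    W j = sign j * (w j * D j)
    distribute : ∀ s y z d → s * ((y + μ * z) * d) ≈ s * (y * d) + μ * (s * (z * d))
    distribute s y z d =
      solve 5 (λ s y z d m → s :* ((y :+ m :* z) :* d) := s :* (y :* d) :+ m :* (s :* (z :* d))) refl s y z d μ

  term≈0 : ∀ s y {d} → d ≈ 0# → s * (y * d) ≈ 0#
  term≈0 s y d≈0 = trans (*-congˡ (trans (*-congˡ d≈0) (zeroʳ y))) (zeroʳ s)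

  det-firstColumn : ∀ n (M : Matrix (suc n)) → (∀ i → M (suc i) zero ≈ 0#) →
                    det (suc n) M ≈ M zero zero * det n (minor M zero)
  det-zeroColumn : ∀ n (M : Matrix (suc n)) → (∀ i → M i zero ≈ 0#) → det (suc n) M ≈ 0#

  det-firstColumn n M below≈0 = begin
    det (suc n) M
      ≈⟨ det-expand n M ⟩
    1# * (M zero zero * det n (minor M zero)) + sum (λ j → sign (suc j) * (M zero (suc j) * det n (minor M (suc j))))
      ≈⟨ +-cong (*-identityˡ _) (sum-≈0 (otherTerms≈0 M below≈0)) ⟩
    M zero zero * det n (minor M zero) + 0#
      ≈⟨ +-identityʳ _ ⟩
    M zero zero * det n (minor M zero)
      ∎
    where
    otherTerms≈0 : ∀ {m} (N : Matrix (suc m)) → (∀ i → N (suc i) zero ≈ 0#) →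
                   ∀ j → sign (suc j) * (N zero (suc j) * det m (minor N (suc j))) ≈ 0#
    otherTerms≈0 {suc m} N N-below≈0 j = term≈0 _ _ (det-zeroColumn m (minor N (suc j)) N-below≈0)

  det-zeroColumn n M column≈0 = begin
    det (suc n) M                       ≈⟨ det-firstColumn n M (column≈0 ∘ suc) ⟩
    M zero zero * det n (minor M zero)  ≈⟨ *-congʳ (column≈0 zero) ⟩
    0# * det n (minor M zero)           ≈⟨ zeroˡ _ ⟩
    0#                                  ∎

  -1*-1≈1 : - 1# * - 1# ≈ 1#
  -1*-1≈1 = trans (-1*x≈-x (- 1#)) (-‿involutive 1#)

  doubleSum : ∀ n → (Fin (suc n) → Carrier) → (Fin (suc n) → Fin n → Carrier) → Carrier
  doubleSum n u Ψ = sum λ j → sign j * (u j * sum λ k → sign k * (u (punchIn j k) * Ψ j k))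

  doubleSum-cong : ∀ n u {Ψ Ψ′ : Fin (suc n) → Fin n → Carrier} →
                   (∀ j k → Ψ j k ≈ Ψ′ j k) → doubleSum n u Ψ ≈ doubleSum n u Ψ′
  doubleSum-cong n u Ψ≈Ψ′ =
    sum-cong-≋ (λ j → term-congʳ j (u j) (sum-cong-≋ (λ k → term-congʳ k (u (punchIn j k)) (Ψ≈Ψ′ j k))))

  doubleSum-peel : ∀ n u Ψ → (∀ j → Ψ (suc j) zero ≈ Ψ zero j) →
                   doubleSum (suc n) u Ψ ≈ doubleSum n (u ∘ suc) (λ j k → Ψ (suc j) (suc k))
  -- The terms with j = 0 cancel against those with k = 0, by Ψ-swap and the sign change.
  doubleSum-peel n u Ψ Ψ-swap = begin
    doubleSum (suc n) u Ψ
      ≡⟨⟩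
    1# * (u zero * sum A) + sum (λ j → (- 1# * sign j) * (u (suc j) * (1# * (u zero * Ψ (suc j) zero) + sum (λ k → (- 1# * sign k) * Y j k))))
      ≈⟨ +-congˡ (sum-cong-≋ pairTerm) ⟩
    1# * (u zero * sum A) + sum (λ j → B j + - u zero * A j)
      ≈⟨ +-congˡ (sum-linear B A (- u zero)) ⟩
    1# * (u zero * sum A) + (sum B + - u zero * sum A)
      ≈⟨ solve 4 (λ a ā s b → con 1 :* (a :* s) :+ (b :+ ā :* s) := b :+ (a :+ ā) :* s) refl (u zero) (- u zero) (sum A) (sum B) ⟩
    sum B + (u zero + - u zero) * sum A
      ≈⟨ +-congˡ (trans (*-congʳ (-‿inverseʳ (u zero))) (zeroˡ _)) ⟩
    sum B + 0#
      ≈⟨ +-identityʳ _ ⟩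
    sum B
      ∎
    where
    Y : Fin (suc n) → Fin n → Carrier
    Y j k = u (suc (punchIn j k)) * Ψ (suc j) (suc k)
    A B : Fin (suc n) → Carrier
    A j = sign j * (u (suc j) * Ψ zero j)
    B j = sign j * (u (suc j) * sum (λ k → sign k * Y j k))
    pairTerm : ∀ j → (- 1# * sign j) * (u (suc j) * (1# * (u zero * Ψ (suc j) zero) + sum (λ k → (- 1# * sign k) * Y j k)))
                     ≈ B j + - u zero * A j
    pairTerm j = begin
      (- 1# * sign j) * (u (suc j) * (1# * (u zero * Ψ (suc j) zero) + sum (λ k → (- 1# * sign k) * Y j k)))
        ≈⟨ *-congˡ (*-congˡ (+-cong (*-congˡ (*-congˡ (Ψ-swap j))) negated)) ⟩
      (- 1# * sign j) * (u (suc j) * (1# * (u zero * Ψ zero j) + - 1# * W))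
        ≈⟨ solve 6 (λ m s v a p w → (m :* s) :* (v :* (con 1 :* (a :* p) :+ m :* w)) := (m :* m) :* (s :* (v :* w)) :+ (m :* a) :* (s :* (v :* p))) refl
             (- 1#) (sign j) (u (suc j)) (u zero) (Ψ zero j) W ⟩
      (- 1# * - 1#) * B j + (- 1# * u zero) * A j
        ≈⟨ +-cong (trans (*-congʳ -1*-1≈1) (*-identityˡ _)) (*-congʳ (-1*x≈-x (u zero))) ⟩
      B j + - u zero * A j
        ∎
      where
      W : Carrier
      W = sum (λ k → sign k * Y j k)
      negated : sum (λ k → (- 1# * sign k) * Y j k) ≈ - 1# * W
      negated = trans (sum-cong-≋ (λ k → *-assoc (- 1#) (sign k) (Y j k))) (sym (*-distribˡ-sum (- 1#) (λ k → sign k * Y j k)))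

  -- Φ receives the increasing enumeration of the columns other than j and punchIn j k.
  alternatingPairSum : ∀ m → (Fin (suc (suc m)) → Carrier) → ((Fin m → Fin (suc (suc m))) → Carrier) → Carrier
  alternatingPairSum m u Φ = doubleSum (suc m) u (λ j k → Φ (punchIn j ∘ punchIn k))

  alternatingPairSum≈0 : ∀ m u Φ → Φ Preserves _≗_ ⟶ _≈_ → alternatingPairSum m u Φ ≈ 0#
  alternatingPairSum≈0 zero u Φ _ =
    trans (doubleSum-peel zero u (λ j k → Φ (punchIn j ∘ punchIn k)) (λ _ → refl)) (sum-≈0 (λ j → term≈0 (sign j) (u (suc j)) refl))
  alternatingPairSum≈0 (suc m) u Φ Φ-cong = begin
    alternatingPairSum (suc m) u Φ
      ≈⟨ doubleSum-peel (suc m) u (λ j k → Φ (punchIn j ∘ punchIn k)) (λ _ → refl) ⟩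
    doubleSum (suc m) (u ∘ suc) (λ j k → Φ (punchIn (suc j) ∘ punchIn (suc k)))
      ≈⟨ doubleSum-cong (suc m) (u ∘ suc) (λ j k → Φ-cong (punchIn-suc-lift j k)) ⟩
    alternatingPairSum m (u ∘ suc) (Φ ∘ lift 1)
      ≈⟨ alternatingPairSum≈0 m (u ∘ suc) (Φ ∘ lift 1) (Φ-cong ∘ lift₁-cong) ⟩
    0#
      ∎
    where
    punchIn-suc-lift : ∀ (j : Fin (suc (suc m))) (k : Fin (suc m)) →
                       punchIn (suc j) ∘ punchIn (suc k) ≗ lift 1 (punchIn j ∘ punchIn k)
    punchIn-suc-lift j k zero    = ≡.refl
    punchIn-suc-lift j k (suc l) = ≡.refl
    lift₁-cong : ∀ {f g : Fin m → Fin (suc (suc m))} → f ≗ g → lift 1 f ≗ lift 1 g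
    lift₁-cong f≗g zero    = ≡.refl
    lift₁-cong f≗g (suc l) = ≡.cong suc (f≗g l)

  det-equalFirstRows : ∀ m (M : Matrix (suc (suc m))) → (∀ j → M (suc zero) j ≈ M zero j) →
                       det (suc (suc m)) M ≈ 0#
  det-equalFirstRows m M row₁≈row₀ = begin
    det (suc (suc m)) M
      ≈⟨ det-expand (suc m) M ⟩
    sum (λ j → sign j * (M zero j * det (suc m) (minor M j)))
      ≈⟨ sum-cong-≋ (λ j → term-congʳ j (M zero j) (trans (det-expand m (minor M j)) (sum-cong-≋ (λ k → term-cong k (row₁≈row₀ (punchIn j k)) (refl {det m (minor (minor M j) k)}))))) ⟩
    alternatingPairSum m (M zero) Φ
      ≈⟨ alternatingPairSum≈0 m (M zero) Φ Φ-cong ⟩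
    0#
      ∎
    where
    Φ : (Fin m → Fin (suc (suc m))) → Carrier
    Φ columns = det m (λ i l → M (suc (suc i)) (columns l))
    Φ-cong : Φ Preserves _≗_ ⟶ _≈_
    Φ-cong c≗c′ = det-cong m (λ i l → reflexive (≡.cong (M (suc (suc i))) (c≗c′ l)))

  addPreviousRow : ∀ {n m} → Carrier → (Fin n → Fin m → Carrier) → Fin n → Fin m → Carrier
  addPreviousRow μ M zero    j = M zero j
  addPreviousRow μ M (suc i) j = M (suc i) j + μ * M (inject₁ i) j

  det-addPreviousRow : ∀ n μ (M : Matrix n) → det n (addPreviousRow μ M) ≈ det n M
  det-addPreviousRow zero          μ M = refl
  det-addPreviousRow (suc zero)    μ M = refl
  det-addPreviousRow (suc (suc n)) μ M = begin
    det (suc (suc n)) M′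
      ≈⟨ det-expand (suc n) M′ ⟩
    sum (λ j → sign j * (M zero j * det (suc n) (minor M′ j)))
      ≈⟨ sum-cong-≋ (λ j → term-congʳ j (M zero j) (minor-addPreviousRow j (det-addPreviousRow (suc n) μ (minor M j)))) ⟩
    sum (λ j → sign j * (M zero j * (det (suc n) (minor M j) + μ * det (suc n) (minor N j))))
      ≈⟨ sum-cong-≋ (λ j → distribute (sign j) (M zero j) (det (suc n) (minor M j)) (det (suc n) (minor N j))) ⟩
    sum (λ j → U j + μ * V j)
      ≈⟨ sum-linear U V μ ⟩
    sum U + μ * sum V
      ≈⟨ +-cong (det-expand (suc n) M) (*-congˡ (det-expand (suc n) N)) ⟨
    det (suc (suc n)) M + μ * det (suc (suc n)) N
      ≈⟨ +-congˡ (trans (*-congˡ (det-equalFirstRows n N (λ _ → refl))) (zeroʳ μ)) ⟩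
    det (suc (suc n)) M + 0#
      ≈⟨ +-identityʳ _ ⟩
    det (suc (suc n)) M
      ∎
    where
    M′ N : Matrix (suc (suc n))
    M′ = addPreviousRow μ M
    N = M zero ∷ M zero ∷ tail (tail M′)
    U V : Fin (suc (suc n)) → Carrier
    U j = sign j * (M zero j * det (suc n) (minor M j))
    V j = sign j * (M zero j * det (suc n) (minor N j))
    distribute : ∀ s y a b → s * (y * (a + μ * b)) ≈ s * (y * a) + μ * (s * (y * b))
    distribute s y a b =
      solve 5 (λ s y a b m → s :* (y :* (a :+ m :* b)) := s :* (y :* a) :+ m :* (s :* (y :* b))) refl s y a b μ
    -- The matrices in this chain agree with minor M′ j, addPreviousRow μ F and minor N j only
    -- pointwise, but det (suc n) inspects its argument only at rows zero and suc i.
    minor-addPreviousRow : ∀ j → det (suc n) (addPreviousRow μ (minor M j)) ≈ det (suc n) (minor M j) →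
                           det (suc n) (minor M′ j) ≈ det (suc n) (minor M j) + μ * det (suc n) (minor N j)
    minor-addPreviousRow j ih = begin
      det (suc n) (minor M′ j)
        ≡⟨⟩
      det (suc n) ((λ k → F zero k + μ * M zero (punchIn j k)) ∷ tail (addPreviousRow μ F))
        ≈⟨ det-linearFirstRow n (F zero) (M zero ∘ punchIn j) μ (tail (addPreviousRow μ F)) ⟩
      det (suc n) (addPreviousRow μ F) + μ * det (suc n) (minor N j)
        ≈⟨ +-congʳ ih ⟩
      det (suc n) F + μ * det (suc n) (minor N j)
        ∎
      where
      F : Matrix (suc n)
      F = minor M j


module DelannoyArrays {c ℓ : Level} (R : CommutativeRing c ℓ) where
  open CommutativeRing R hiding (zero)
  open RingDefs R
  open Determinant R
  open import Algebra.Properties.Ring ring using (-‿distribˡ-*)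
  open import Algebra.Properties.CommutativeSemiring.Exp commutativeSemiring
    using (_^_; ^-congˡ; ^-homo-*; ^-distrib-*)
  open import Algebra.Solver.Ring.NaturalCoefficients.Default commutativeSemiring
  open import Relation.Binary.Reasoning.Setoid setoid

  pow≡^ : ∀ y n → pow y n ≡ y ^ n
  pow≡^ y zero    = ≡.refl
  pow≡^ y (suc n) = ≡.cong (y *_) (pow≡^ y n)

  pow-cong : ∀ n {y z} → y ≈ z → pow y n ≈ pow z n
  pow-cong n {y} {z} y≈z = begin
    pow y n  ≡⟨ pow≡^ y n ⟩
    y ^ n    ≈⟨ ^-congˡ n y≈z ⟩
    z ^ n    ≡⟨ pow≡^ z n ⟨
    pow z n  ∎

  DelannoyRecurrence : Carrier → (ℕ → ℕ → Carrier) → Set ℓ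
  DelannoyRecurrence x a = ∀ i j → a (suc i) (suc j) ≈ a i (suc j) + a (suc i) j + x * a i j

  GeometricFirstColumn : Carrier → (ℕ → ℕ → Carrier) → Set ℓ
  GeometricFirstColumn ρ a = ∀ i → a (suc i) 0 ≈ ρ * a i 0

  topLeft : ∀ n → (ℕ → ℕ → Carrier) → Matrix n
  topLeft n a i j = a (toℕ i) (toℕ j)

  eliminate : Carrier → (ℕ → ℕ → Carrier) → ℕ → ℕ → Carrier
  eliminate μ a i j = a (suc i) (suc j) + μ * a i (suc j)

  firstColumn-cancel : ∀ {ρ μ} a → ρ + μ ≈ 0# → GeometricFirstColumn ρ a → ∀ i → a (suc i) 0 + μ * a i 0 ≈ 0#
  firstColumn-cancel {ρ} {μ} a ρ+μ≈0 geometric i = begin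
    a (suc i) 0 + μ * a i 0   ≈⟨ +-congʳ (geometric i) ⟩
    ρ * a i 0 + μ * a i 0     ≈⟨ distribʳ (a i 0) ρ μ ⟨
    (ρ + μ) * a i 0           ≈⟨ *-congʳ ρ+μ≈0 ⟩
    0# * a i 0                ≈⟨ zeroˡ (a i 0) ⟩
    0#                        ∎

  eliminate-recurrence : ∀ {x} μ a → DelannoyRecurrence x a → DelannoyRecurrence x (eliminate μ a)
  eliminate-recurrence {x} μ a rec i j =
    trans (+-cong (rec (suc i) (suc j)) (*-congˡ (rec i (suc j))))
      (solve 7 (λ A B C E F x m → (A :+ B :+ x :* C) :+ m :* (E :+ C :+ x :* F)
                                := (A :+ m :* E) :+ (B :+ m :* C) :+ x :* (C :+ m :* F)) refl
        (a (suc i) (suc (suc j))) (a (suc (suc i)) (suc j)) (a (suc i) (suc j)) (a i (suc (suc j))) (a i (suc j)) x μ)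

  eliminate-constantColumn : ∀ {x ρ μ} a → DelannoyRecurrence x a → ρ + μ ≈ 0# → GeometricFirstColumn ρ a →
                             GeometricFirstColumn 1# (eliminate μ a)
  eliminate-constantColumn {x} {μ = μ} a rec ρ+μ≈0 geometric i = begin
    a (suc (suc i)) 1 + μ * a (suc i) 1
      ≈⟨ +-congˡ (*-congˡ (rec i 0)) ⟩
    a (suc (suc i)) 1 + μ * (a i 1 + a (suc i) 0 + x * a i 0)
      ≈⟨ +-congʳ (rec (suc i) 0) ⟩
    a (suc i) 1 + a (suc (suc i)) 0 + x * a (suc i) 0 + μ * (a i 1 + a (suc i) 0 + x * a i 0)
      ≈⟨ solve 7 (λ A B p′ p q x m → A :+ p′ :+ x :* p :+ m :* (B :+ p :+ x :* q)
                                     := con 1 :* (A :+ m :* B) :+ (p′ :+ m :* p) :+ x :* (p :+ m :* q)) refl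
           (a (suc i) 1) (a i 1) (a (suc (suc i)) 0) (a (suc i) 0) (a i 0) x μ ⟩
    1# * (a (suc i) 1 + μ * a i 1) + (a (suc (suc i)) 0 + μ * a (suc i) 0) + x * (a (suc i) 0 + μ * a i 0)
      ≈⟨ +-cong (+-congˡ (cancel (suc i))) (*-congˡ (cancel i)) ⟩
    1# * (a (suc i) 1 + μ * a i 1) + 0# + x * 0#
      ≈⟨ trans (+-cong (+-identityʳ _) (zeroʳ x)) (+-identityʳ _) ⟩
    1# * (a (suc i) 1 + μ * a i 1)
      ∎
    where
    cancel : ∀ i → a (suc i) 0 + μ * a i 0 ≈ 0#
    cancel = firstColumn-cancel a ρ+μ≈0 geometric

  eliminate-corner : ∀ {x} μ a → DelannoyRecurrence x a → eliminate μ a 0 0 ≈ a 1 0 + x * a 0 0 + (1# + μ) * a 0 1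
  eliminate-corner {x} μ a rec =
    trans (+-congʳ (rec 0 0))
      (solve 5 (λ b c d x m → b :+ c :+ x :* d :+ m :* b := c :+ x :* d :+ (con 1 :+ m) :* b) refl (a 0 1) (a 1 0) (a 0 0) x μ)

  det-eliminate : ∀ n {ρ μ} a → ρ + μ ≈ 0# → GeometricFirstColumn ρ a →
                  det (suc n) (topLeft (suc n) a) ≈ a 0 0 * det n (topLeft n (eliminate μ a))
  det-eliminate n {μ = μ} a ρ+μ≈0 geometric = begin
    det (suc n) A
      ≈⟨ det-addPreviousRow (suc n) μ A ⟨
    det (suc n) (addPreviousRow μ A)
      ≈⟨ det-firstColumn n (addPreviousRow μ A) (λ i → trans (+-congˡ (*-congˡ (at-inject₁ i 0))) (firstColumn-cancel a ρ+μ≈0 geometric (toℕ i))) ⟩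
    a 0 0 * det n (minor (addPreviousRow μ A) zero)
      ≈⟨ *-congˡ (det-cong n (λ i k → +-congˡ (*-congˡ (at-inject₁ i (suc (toℕ k)))))) ⟩
    a 0 0 * det n (topLeft n (eliminate μ a))
      ∎
    where
    A : Matrix (suc n)
    A = topLeft (suc n) a
    at-inject₁ : ∀ (i : Fin n) j → a (toℕ (inject₁ i)) j ≈ a (toℕ i) j
    at-inject₁ i j = reflexive (≡.cong (λ r → a r j) (toℕ-inject₁ i))

  eliminate-corner-initial : ∀ {x ρ σ} a → DelannoyRecurrence x a → a 0 0 ≈ 1# → a 1 0 ≈ ρ → a 0 1 ≈ σ →
                             eliminate (- ρ) a 0 0 ≈ x + ρ + σ + - (ρ * σ)
  eliminate-corner-initial {x} {ρ} {σ} a rec a₀₀≈1 a₁₀≈ρ a₀₁≈σ = begin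
    eliminate (- ρ) a 0 0
      ≈⟨ eliminate-corner (- ρ) a rec ⟩
    a 1 0 + x * a 0 0 + (1# + - ρ) * a 0 1
      ≈⟨ +-cong (+-cong a₁₀≈ρ (*-congˡ a₀₀≈1)) (*-congˡ a₀₁≈σ) ⟩
    ρ + x * 1# + (1# + - ρ) * σ
      ≈⟨ solve 4 (λ x ρ σ ν → ρ :+ x :* con 1 :+ (con 1 :+ ν) :* σ := x :+ ρ :+ σ :+ ν :* σ) refl x ρ σ (- ρ) ⟩
    x + ρ + σ + - ρ * σ
      ≈⟨ +-congˡ (-‿distribˡ-* ρ σ) ⟨
    x + ρ + σ + - (ρ * σ)
      ∎

  det-constantColumn : ∀ {x} n b → DelannoyRecurrence x b → GeometricFirstColumn 1# b →
                       det n (topLeft n b) ≈ pow (b 0 0) n * pow (1# + x) (n C 2)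
  det-constantColumn zero _ _ _ = sym (*-identityˡ 1#)
  det-constantColumn {x} (suc n) b rec constant = begin
    det (suc n) (topLeft (suc n) b)
      ≈⟨ det-eliminate n b 1-1≈0 constant ⟩
    b 0 0 * det n (topLeft n e)
      ≈⟨ *-congˡ (det-constantColumn n e (eliminate-recurrence (- 1#) b rec) (eliminate-constantColumn b rec 1-1≈0 constant)) ⟩
    b 0 0 * (pow (e 0 0) n * pow (1# + x) (n C 2))
      ≡⟨ ≡.cong₂ (λ p q → b 0 0 * (p * q)) (pow≡^ (e 0 0) n) (pow≡^ (1# + x) (n C 2)) ⟩
    b 0 0 * (e 0 0 ^ n * (1# + x) ^ (n C 2))
      ≈⟨ *-congˡ (*-congʳ (trans (^-congˡ n corner) (^-distrib-* (1# + x) (b 0 0) n))) ⟩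
    b 0 0 * ((1# + x) ^ n * b 0 0 ^ n * (1# + x) ^ (n C 2))
      ≈⟨ solve 4 (λ b y z w → b :* (y :* z :* w) := (b :* z) :* (y :* w)) refl (b 0 0) ((1# + x) ^ n) (b 0 0 ^ n) ((1# + x) ^ (n C 2)) ⟩
    b 0 0 ^ suc n * ((1# + x) ^ n * (1# + x) ^ (n C 2))
      ≈⟨ *-congˡ (^-homo-* (1# + x) n (n C 2)) ⟨
    b 0 0 ^ suc n * (1# + x) ^ (n ℕ.+ n C 2)
      ≡⟨ ≡.cong₂ _*_ (pow≡^ (b 0 0) (suc n)) (≡.trans (pow≡^ (1# + x) (suc n C 2)) (≡.cong ((1# + x) ^_) pascal)) ⟨
    pow (b 0 0) (suc n) * pow (1# + x) (suc n C 2)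
      ∎
    where
    e : ℕ → ℕ → Carrier
    e = eliminate (- 1#) b
    1-1≈0 : 1# + - 1# ≈ 0#
    1-1≈0 = -‿inverseʳ 1#
    corner : e 0 0 ≈ (1# + x) * b 0 0
    corner = begin
      e 0 0
        ≈⟨ eliminate-corner (- 1#) b rec ⟩
      b 1 0 + x * b 0 0 + (1# + - 1#) * b 0 1
        ≈⟨ +-cong (+-congʳ (constant 0)) (trans (*-congʳ 1-1≈0) (zeroˡ (b 0 1))) ⟩
      1# * b 0 0 + x * b 0 0 + 0#
        ≈⟨ solve 2 (λ b x → con 1 :* b :+ x :* b :+ con 0 := (con 1 :+ x) :* b) refl (b 0 0) x ⟩
      (1# + x) * b 0 0
        ∎
    pascal : suc n C 2 ≡ n ℕ.+ n C 2
    pascal = ≡.trans (≡.sym (nCk+nC[k+1]≡[n+1]C[k+1] n 1)) (≡.cong (ℕ._+ n C 2) (nC1≡n n))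

theorem1 : ∀ {c ℓ : Level} (R : CommutativeRing c ℓ) →
    let open CommutativeRing R
        open RingDefs R
    in (x ρ σ : Carrier) (a : ℕ → ℕ → Carrier) →
       (∀ i j → a (suc i) (suc j) ≈ a i (suc j) + a (suc i) j + x * a i j) →
       (∀ i → a i 0 ≈ pow ρ i) →
       (∀ i → a 0 i ≈ pow σ i) →
       (n : ℕ) → 1 ≤ n →
       det n (λ i j → a (toℕ i) (toℕ j))
         ≈ pow (1# + x) ((n ∸ 1) C 2) * pow (x + ρ + σ + - (ρ * σ)) (n ∸ 1)
theorem1 R x ρ σ a rec a-column a-row (suc m) _ = begin
  det (suc m) (topLeft (suc m) a)
    ≈⟨ det-eliminate m a ρ-ρ≈0 geometric ⟩
  a 0 0 * det m (topLeft m b)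
    ≈⟨ *-cong (a-column 0) (det-constantColumn m b (eliminate-recurrence (- ρ) a rec) (eliminate-constantColumn a rec ρ-ρ≈0 geometric)) ⟩
  1# * (pow (b 0 0) m * pow (1# + x) (m C 2))
    ≈⟨ trans (*-identityˡ _) (*-comm _ _) ⟩
  pow (1# + x) (m C 2) * pow (b 0 0) m
    ≈⟨ *-congˡ (pow-cong m (eliminate-corner-initial a rec (a-column 0) (trans (a-column 1) (*-identityʳ ρ)) (trans (a-row 1) (*-identityʳ σ)))) ⟩
  pow (1# + x) (m C 2) * pow (x + ρ + σ + - (ρ * σ)) m
    ∎
  where
  open CommutativeRing R
  open RingDefs R
  open Determinant R
  open DelannoyArrays R
  open import Relation.Binary.Reasoning.Setoid setoid
  b : ℕ → ℕ → Carrier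
  b = eliminate (- ρ) a
  ρ-ρ≈0 : ρ + - ρ ≈ 0#
  ρ-ρ≈0 = -‿inverseʳ ρ
  geometric : GeometricFirstColumn ρ a
  geometric i = trans (a-column (suc i)) (*-congˡ (sym (a-column i)))
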